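{- Let $a\ge 3$ and $n\ge 5$ be integers, and let $F(a)=\dfrac{\ln\left(1-\frac{3}{a+1}\right)}{\ln\left(1-\frac{1}{a+1}\right)}$. Let $G\in\mathcal{T}_{2,2}(a,n)$ with canonical partition $V_0\cup V_1$, and set $x=|V_0|$. Then $P(G)$ is maximum among all graphs in $\mathcal{T}_{2,2}(a,n)$ if and only if $$n\in\big((x-1)F(a)+x,\; xF(a)+x+1\big].$$ Moreover, for such $n$ and $x$, $$\Pi_{2,2}(a,n)=(a-2)^{\binom{x}{2}}a^{\binom{n-x}{2}}(a+1)^{x(n-x)}.$$
   Context: A multigraph is a pair $G=(V,w)$ with $w:\binom{V}{2}\to\mathbb{Z}_{\ge 0}$, and $P(G)=\prod_{xy\in\binom{V}{2}}w(xy)$. For an integer $a\ge 3$ and $n\in\mathbb{N}$, $\mathcal{T}_{2,2}(a,n)$ is the set of multigraphs $G$ on $[n]$ whose vertex set can be partitioned into two parts $V_0,V_1$ (the canonical partition) such that all edges inside $V_0$ have multiplicity $a-2$, all edges inside $V_1$ have multiplicity $a$, and all edges between $V_0$ and $V_1$ have multiplicity $a+1$. $\Pi_{2,2}(a,n)=\max\{P(G):G\in\mathcal{T}_{2,2}(a,n)\}$. -}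

module Defs where

open import Data.Nat using (ℕ; zero; suc; _+_; _*_; _∸_; _^_; _≤_; _<_)
open import Data.Nat.Properties using (_<?_)
open import Data.Nat.Combinatorics using (_C_)
open import Data.Bool using (Bool; true; false; _≟_)
open import Data.Fin using (Fin; toℕ)
open import Data.Nat.ListAction using (product)
open import Data.List using (List; map; filter; length; allFin; cartesianProduct)
open import Data.Product using (Σ; ∃; _×_; _,_; proj₁; proj₂)
open import Relation.Binary.PropositionalEquality using (_≡_; _≢_)

-- A multigraph on [n] = Fin n, given by its multiplicity function w.
-- Only the values w i j with i ≠ j are meaningful (unordered pairs).
Multigraph : ℕ → Set
Multigraph n = Fin n → Fin n → ℕ

pairs : (n : ℕ) → List (Fin n × Fin n)
pairs n = filter (λ p → toℕ (proj₁ p) <? toℕ (proj₂ p)) (cartesianProduct (allFin n) (allFin n))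

P : (n : ℕ) → Multigraph n → ℕ
P n w = product (map (λ p → w (proj₁ p) (proj₂ p)) (pairs n))

-- Partition of [n] into V₀ (label false) and V₁ (label true)
-- multiplicity prescribed by T_{2,2}(a,n)
mult : ℕ → Bool → Bool → ℕ
mult a false false = a ∸ 2
mult a true  true  = a
mult a false true  = a + 1
mult a true  false = a + 1

HasPartition : (a n : ℕ) → (Fin n → Bool) → Multigraph n → Set
HasPartition a n part w = ∀ i j → i ≢ j → w i j ≡ mult a (part i) (part j)

InT22 : (a n : ℕ) → Multigraph n → Set
InT22 a n w = Σ (Fin n → Bool) λ part → HasPartition a n part w

sizeV₀ : (n : ℕ) → (Fin n → Bool) → ℕ
sizeV₀ n part = length (filter (λ i → part i ≟ false) (allFin n))

IsExtremal : (a n : ℕ) → Multigraph n → Set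
IsExtremal a n w = ∀ w' → InT22 a n w' → P n w' ≤ P n w

IsΠ22 : (a n m : ℕ) → Set
IsΠ22 a n m = (Σ (Multigraph n) λ w → InT22 a n w × P n w ≡ m)
            × (∀ w → InT22 a n w → P n w ≤ m)

-- The condition  n ∈ ((x-1)F(a)+x , xF(a)+x+1],  F(a) = ln(1-3/(a+1)) / ln(1-1/(a+1)),
-- rewritten (exactly equivalently, for a ≥ 3 and 0 ≤ x ≤ n) by multiplying by the
-- negative number ln(a/(a+1)) and exponentiating:
--   lower:  (n-x) ln(a/(a+1)) < (x-1) ln((a-2)/(a+1))
--       ⇔  a^(n-x) (a-2) (a+1)^x < (a-2)^x (a+1)^(n-x+1)
--   upper:  (n-x-1) ln(a/(a+1)) ≥ x ln((a-2)/(a+1))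
--       ⇔  a (a-2)^x (a+1)^(n-x) ≤ a^(n-x) (a+1)^(x+1)
InWindow : (a n x : ℕ) → Set
InWindow a n x =
  (a ^ (n ∸ x) * (a ∸ 2) * (a + 1) ^ x < (a ∸ 2) ^ x * (a + 1) ^ (n ∸ x + 1))
  × (a * (a ∸ 2) ^ x * (a + 1) ^ (n ∸ x) ≤ a ^ (n ∸ x) * (a + 1) ^ (x + 1))

Π-formula : (a n x : ℕ) → ℕ
Π-formula a n x = (a ∸ 2) ^ (x C 2) * a ^ ((n ∸ x) C 2) * (a + 1) ^ (x * (n ∸ x))

{-# OPTIONS --safe #-}
module Submission where

-- P(G) depends only on x = |V₀|: it is h(x) = (a-2)^C(x,2) a^C(n-x,2) (a+1)^(x(n-x)), and every
-- 0 ≤ x ≤ n is realised, so G is extremal iff x maximises h on [0, n].  Moving a vertex from V₁ to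
-- V₀ multiplies h by (a-2)^x (a+1)^y / ((a+1)^x a^y), where y = n-x-1, and each increase of x
-- multiplies this ratio by a(a-2)/(a+1)² < 1.  So h is strictly log-concave, and is maximal exactly
-- where it stops rising; after clearing denominators the two inequalities of the window say
-- h(x-1) < h(x) and h(x+1) ≤ h(x).  The first is strict at a maximum because adjacent values never
-- tie: (a+1)^x a^y = (a-2)^x (a+1)^y forces x = y = 0, as a+1 is coprime to a.

open import Defs
open import Data.Nat
  using (ℕ; zero; suc; _+_; _*_; _∸_; _^_; _≤_; _<_; z≤n; z<s; s≤s; s≤s⁻¹; NonZero; >-nonZero; >-nonZero⁻¹)
open import Data.Nat.Properties hiding (_≟_)
open import Data.Nat.Combinatorics using (_C_; nC1≡n; nCk+nC[k+1]≡[n+1]C[k+1])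
open import Data.Nat.Coprimality using (Coprime; coprime-divisor; coprime-+; 1-coprimeTo)
open import Data.Nat.Divisibility using (_∣_; divides; ∣1⇒≡1)
open import Data.Nat.ListAction using (product)
open import Data.Nat.ListAction.Properties using (product-++)
open import Data.Nat.Solver using (module +-*-Solver)
open import Data.Bool using (Bool; true; false; not; if_then_else_; _≟_)
open import Data.Fin using (Fin; toℕ; zero; suc)
open import Data.List using ([]; _∷_; _++_; map; filter; length; tabulate; allFin; cartesianProduct)
open import Data.List.Properties using (map-++; map-∘; map-tabulate; tabulate-cong)
open import Data.Product using (Σ; _×_; _,_)
open import Data.Product.Function.NonDependent.Propositional using (_×-⇔_)
open import Data.Sum using (inj₁; inj₂)
open import Data.Unit using (⊤; tt)
open import Data.Empty using (⊥-elim)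
open import Function using (_∘_; _$_; id; const)
open import Function.Bundles using (_⇔_; mk⇔; Equivalence)
open import Function.Properties.Equivalence using (⇔-setoid)
open import Level using (0ℓ)
open import Relation.Nullary using (Dec; yes; no; does; ¬_)
open import Relation.Unary using (Decidable)
open import Relation.Binary.Bundles using (Setoid)
open import Relation.Binary.PropositionalEquality
import Relation.Binary.Reasoning.Setoid as SetoidReasoning
open import Algebra.Properties.CommutativeSemigroup *-commutativeSemigroup using (x∙yz≈y∙xz)

open +-*-Solver using (solve; _:*_; _:=_)
open Setoid (⇔-setoid 0ℓ) using () renaming (sym to ⇔-sym; trans to ⇔-trans)
module ⇔-Reasoning = SetoidReasoning (⇔-setoid 0ℓ)

-- The product P over a two-coloured complete graph

∏ : (n : ℕ) → (Fin n → ℕ) → ℕ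
∏ n f = product (tabulate f)

∏-cong : ∀ {n} {f g : Fin n → ℕ} → f ≗ g → ∏ n f ≡ ∏ n g
∏-cong eq = cong product (tabulate-cong eq)

product-map-filter : ∀ {A : Set} {Q : A → Set} (Q? : Decidable Q) (f : A → ℕ) xs →
  product (map f (filter Q? xs)) ≡ product (map (λ x → if does (Q? x) then f x else 1) xs)
product-map-filter Q? f []       = refl
product-map-filter Q? f (x ∷ xs) with does (Q? x)
... | true  = cong (f x *_) (product-map-filter Q? f xs)
... | false = trans (product-map-filter Q? f xs) (sym (+-identityʳ _))

product-map-cartesianProduct : ∀ {A B : Set} (f : A × B → ℕ) xs ys →
  product (map f (cartesianProduct xs ys)) ≡ product (map (λ x → product (map (λ y → f (x , y)) ys)) xs)
product-map-cartesianProduct f []       ys = refl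
product-map-cartesianProduct f (x ∷ xs) ys = begin
  product (map f (map (x ,_) ys ++ cartesianProduct xs ys))
    ≡⟨ cong product (map-++ f (map (x ,_) ys) _) ⟩
  product (map f (map (x ,_) ys) ++ map f (cartesianProduct xs ys))
    ≡⟨ product-++ (map f (map (x ,_) ys)) _ ⟩
  product (map f (map (x ,_) ys)) * product (map f (cartesianProduct xs ys))
    ≡⟨ cong₂ _*_ (cong product (sym (map-∘ ys))) (product-map-cartesianProduct f xs ys) ⟩
  product (map (λ y → f (x , y)) ys) * product (map (λ x → product (map (λ y → f (x , y)) ys)) xs) ∎
  where open ≡-Reasoning

upperProduct : (n : ℕ) → (Fin n → Fin n → ℕ) → ℕ
upperProduct n g = ∏ n λ i → ∏ n λ j → if does (toℕ i <? toℕ j) then g i j else 1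

P≡upperProduct : ∀ n w → P n w ≡ upperProduct n w
P≡upperProduct n w = begin
  P n w
    ≡⟨ product-map-filter (λ (i , j) → toℕ i <? toℕ j) (λ (i , j) → w i j)
                          (cartesianProduct (allFin n) (allFin n)) ⟩
  product (map entry (cartesianProduct (allFin n) (allFin n)))
    ≡⟨ product-map-cartesianProduct entry (allFin n) (allFin n) ⟩
  product (map (λ i → product (map (λ j → entry (i , j)) (allFin n))) (allFin n))
    ≡⟨ cong product (map-tabulate id (λ i → product (map (λ j → entry (i , j)) (allFin n)))) ⟩
  ∏ n (λ i → product (map (λ j → entry (i , j)) (allFin n)))
    ≡⟨ ∏-cong (λ i → cong product (map-tabulate id (λ j → entry (i , j)))) ⟩
  upperProduct n w ∎
  where
  open ≡-Reasoning
  entry : Fin n × Fin n → ℕ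
  entry (i , j) = if does (toℕ i <? toℕ j) then w i j else 1

upperProduct-suc : ∀ n g →
  upperProduct (suc n) g ≡ ∏ n (g zero ∘ suc) * upperProduct n (λ i j → g (suc i) (suc j))
upperProduct-suc n g = cong₂ _*_ (+-identityʳ (∏ n (g zero ∘ suc)))
  (∏-cong λ i → +-identityʳ (∏ n λ j → if does (toℕ i <? toℕ j) then g (suc i) (suc j) else 1))

upperProduct-cong : ∀ n {g h : Fin n → Fin n → ℕ} →
  (∀ {i j} → toℕ i < toℕ j → g i j ≡ h i j) → upperProduct n g ≡ upperProduct n h
upperProduct-cong n {g} {h} eq = ∏-cong λ i → ∏-cong λ j → entry (toℕ i <? toℕ j)
  where
  entry : ∀ {i j} (i<j? : Dec (toℕ i < toℕ j)) →
    (if does i<j? then g i j else 1) ≡ (if does i<j? then h i j else 1)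
  entry (yes i<j) = eq i<j
  entry (no _)    = refl

countTrue : (n : ℕ) → (Fin n → Bool) → ℕ
countTrue zero    c = 0
countTrue (suc n) c = (if c zero then 1 else 0) + countTrue n (c ∘ suc)

countTrue-not : ∀ n c → countTrue n (not ∘ c) + countTrue n c ≡ n
countTrue-not zero    c = refl
countTrue-not (suc n) c with c zero
... | true  = trans (+-suc _ _) (cong suc (countTrue-not n (c ∘ suc)))
... | false = cong suc (countTrue-not n (c ∘ suc))

length-filter-tabulate : ∀ {A : Set} n (g : Fin n → A) (c : A → Bool) →
  length (filter (λ x → c x ≟ false) (tabulate g)) ≡ countTrue n (not ∘ c ∘ g)
length-filter-tabulate zero    g c = refl
length-filter-tabulate (suc n) g c with c (g zero)
... | true  = length-filter-tabulate n (g ∘ suc) c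
... | false = cong suc (length-filter-tabulate n (g ∘ suc) c)

sizeV₀≡countTrue : ∀ n part → sizeV₀ n part ≡ countTrue n (not ∘ part)
sizeV₀≡countTrue n part = length-filter-tabulate n id part

sizeV₀≤n : ∀ n part → sizeV₀ n part ≤ n
sizeV₀≤n n part = subst₂ _≤_ (sym (sizeV₀≡countTrue n part)) (countTrue-not n part) (m≤m+n _ _)

countTrue≡n∸sizeV₀ : ∀ n part → countTrue n part ≡ n ∸ sizeV₀ n part
countTrue≡n∸sizeV₀ n part = begin
  countTrue n part                                  ≡⟨ m+n∸m≡n (countTrue n (not ∘ part)) _ ⟨
  countTrue n (not ∘ part) + countTrue n part ∸ countTrue n (not ∘ part)
    ≡⟨ cong₂ _∸_ (countTrue-not n part) (sym (sizeV₀≡countTrue n part)) ⟩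
  n ∸ sizeV₀ n part                                 ∎
  where open ≡-Reasoning

∏-colouring : ∀ n (f : Bool → ℕ) (c : Fin n → Bool) →
  ∏ n (f ∘ c) ≡ f false ^ countTrue n (not ∘ c) * f true ^ countTrue n c
∏-colouring zero    f c = refl
∏-colouring (suc n) f c with c zero
... | true  = trans (cong (f true *_) (∏-colouring n f (c ∘ suc)))
                    (x∙yz≈y∙xz (f true) (f false ^ countTrue n (not ∘ c ∘ suc)) _)
... | false = trans (cong (f false *_) (∏-colouring n f (c ∘ suc)))
                    (sym (*-assoc (f false) (f false ^ countTrue n (not ∘ c ∘ suc)) _))

twoBlockProduct : (p q r x y : ℕ) → ℕ
twoBlockProduct p q r x y = p ^ (x C 2) * q ^ (y C 2) * r ^ (x * y)

[1+n]C2≡n+nC2 : ∀ n → suc n C 2 ≡ n + n C 2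
[1+n]C2≡n+nC2 n = trans (sym (nCk+nC[k+1]≡[n+1]C[k+1] n 1)) (cong (_+ n C 2) (nC1≡n n))

module _ (p q r : ℕ) where

  twoBlockProduct-sucˡ : ∀ x y → twoBlockProduct p q r (suc x) y ≡ p ^ x * r ^ y * twoBlockProduct p q r x y
  twoBlockProduct-sucˡ x y = begin
    p ^ (suc x C 2) * q ^ (y C 2) * r ^ (y + x * y)
      ≡⟨ cong (λ e → p ^ e * q ^ (y C 2) * r ^ (y + x * y)) ([1+n]C2≡n+nC2 x) ⟩
    p ^ (x + x C 2) * q ^ (y C 2) * r ^ (y + x * y)
      ≡⟨ cong₂ (λ s t → s * q ^ (y C 2) * t) (^-distribˡ-+-* p x (x C 2)) (^-distribˡ-+-* r y (x * y)) ⟩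
    p ^ x * p ^ (x C 2) * q ^ (y C 2) * (r ^ y * r ^ (x * y))
      ≡⟨ solve 5 (λ px pX qY ry rXY → px :* pX :* qY :* (ry :* rXY) := px :* ry :* (pX :* qY :* rXY)) refl
           (p ^ x) (p ^ (x C 2)) (q ^ (y C 2)) (r ^ y) (r ^ (x * y)) ⟩
    p ^ x * r ^ y * twoBlockProduct p q r x y ∎
    where open ≡-Reasoning

  twoBlockProduct-sucʳ : ∀ x y → twoBlockProduct p q r x (suc y) ≡ r ^ x * q ^ y * twoBlockProduct p q r x y
  twoBlockProduct-sucʳ x y = begin
    p ^ (x C 2) * q ^ (suc y C 2) * r ^ (x * suc y)
      ≡⟨ cong₂ (λ e f → p ^ (x C 2) * q ^ e * r ^ f) ([1+n]C2≡n+nC2 y) (*-suc x y) ⟩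
    p ^ (x C 2) * q ^ (y + y C 2) * r ^ (x + x * y)
      ≡⟨ cong₂ (λ s t → p ^ (x C 2) * s * t) (^-distribˡ-+-* q y (y C 2)) (^-distribˡ-+-* r x (x * y)) ⟩
    p ^ (x C 2) * (q ^ y * q ^ (y C 2)) * (r ^ x * r ^ (x * y))
      ≡⟨ solve 5 (λ pX qy qY rx rXY → pX :* (qy :* qY) :* (rx :* rXY) := rx :* qy :* (pX :* qY :* rXY)) refl
           (p ^ (x C 2)) (q ^ y) (q ^ (y C 2)) (r ^ x) (r ^ (x * y)) ⟩
    r ^ x * q ^ y * twoBlockProduct p q r x y ∎
    where open ≡-Reasoning

upperProduct-colouring : (m : Bool → Bool → ℕ) → m true false ≡ m false true →
  ∀ n (c : Fin n → Bool) →
  upperProduct n (λ i j → m (c i) (c j))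
    ≡ twoBlockProduct (m false false) (m true true) (m false true) (countTrue n (not ∘ c)) (countTrue n c)
upperProduct-colouring m m-sym zero    c = refl
upperProduct-colouring m m-sym (suc n) c = begin
  upperProduct (suc n) (λ i j → m (c i) (c j))
    ≡⟨ upperProduct-suc n (λ i j → m (c i) (c j)) ⟩
  ∏ n (m (c zero) ∘ c ∘ suc) * upperProduct n (λ i j → m (c (suc i)) (c (suc j)))
    ≡⟨ cong₂ _*_ (∏-colouring n (m (c zero)) (c ∘ suc)) (upperProduct-colouring m m-sym n (c ∘ suc)) ⟩
  m (c zero) false ^ x * m (c zero) true ^ y * T x y
    ≡⟨ add-vertex (c zero) ⟩
  T (countTrue (suc n) (not ∘ c)) (countTrue (suc n) c) ∎
  where
  open ≡-Reasoning
  T = twoBlockProduct (m false false) (m true true) (m false true)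
  x = countTrue n (not ∘ c ∘ suc)
  y = countTrue n (c ∘ suc)
  add-vertex : ∀ b →
    m b false ^ x * m b true ^ y * T x y ≡ T ((if not b then 1 else 0) + x) ((if b then 1 else 0) + y)
  add-vertex false = sym (twoBlockProduct-sucˡ _ _ _ x y)
  add-vertex true  = trans (cong (λ e → e ^ x * m true true ^ y * T x y) m-sym)
                           (sym (twoBlockProduct-sucʳ _ _ _ x y))

P≡Π-formula : ∀ {a n part w} → HasPartition a n part w → P n w ≡ Π-formula a n (sizeV₀ n part)
P≡Π-formula {a} {n} {part} {w} hp = begin
  P n w
    ≡⟨ P≡upperProduct n w ⟩
  upperProduct n w
    ≡⟨ upperProduct-cong n (λ i<j → hp _ _ (λ i≡j → <-irrefl (cong toℕ i≡j) i<j)) ⟩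
  upperProduct n (λ i j → mult a (part i) (part j))
    ≡⟨ upperProduct-colouring (mult a) refl n part ⟩
  twoBlockProduct (a ∸ 2) a (a + 1) (countTrue n (not ∘ part)) (countTrue n part)
    ≡⟨ cong₂ (twoBlockProduct (a ∸ 2) a (a + 1))
             (sym (sizeV₀≡countTrue n part)) (countTrue≡n∸sizeV₀ n part) ⟩
  Π-formula a n (sizeV₀ n part) ∎
  where open ≡-Reasoning

canonical : ℕ → ∀ {n} → (Fin n → Bool) → Multigraph n
canonical a part i j = mult a (part i) (part j)

canonical-hasPartition : ∀ a {n} (part : Fin n → Bool) → HasPartition a n part (canonical a part)
canonical-hasPartition a part i j _ = refl

prefixColouring : ℕ → ∀ {n} → Fin n → Bool
prefixColouring zero    _       = true
prefixColouring (suc x) zero    = false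
prefixColouring (suc x) (suc i) = prefixColouring x i

sizeV₀-prefixColouring : ∀ {n x} → x ≤ n → sizeV₀ n (prefixColouring x) ≡ x
sizeV₀-prefixColouring {n} {x} x≤n = trans (sizeV₀≡countTrue n (prefixColouring x)) (falses x≤n)
  where
  falses : ∀ {n x} → x ≤ n → countTrue n (not ∘ prefixColouring x) ≡ x
  falses {zero}  z≤n       = refl
  falses {suc n} z≤n       = falses {n} z≤n
  falses {suc n} (s≤s x≤n) = cong suc (falses x≤n)

-- Maxima of strictly log-concave sequences

module Unimodal (h : ℕ → ℕ) (n : ℕ) where

  StrictlyLogConcave : Set
  StrictlyLogConcave = ∀ u → 2 + u ≤ n → h u * h (2 + u) < h (1 + u) * h (1 + u)

  NoAdjacentTies : Set
  NoAdjacentTies = ∀ u → 1 + u ≤ n → h u ≢ h (1 + u)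

  RisesTo : ℕ → Set
  RisesTo zero    = ⊤
  RisesTo (suc x) = h x < h (suc x)

  FallsFrom : ℕ → Set
  FallsFrom x = 1 + x ≤ n → h (1 + x) ≤ h x

  IsMaximumAt : ℕ → Set
  IsMaximumAt x = ∀ u → u ≤ n → h u ≤ h x

  module _ (logConcave : StrictlyLogConcave) where

    risesTo-pred : ∀ x → 1 + x ≤ n → RisesTo (suc x) → RisesTo x
    risesTo-pred zero    _     _    = tt
    risesTo-pred (suc u) 2+u≤n rise = *-cancelʳ-< (h (1 + u)) (h u) (h (1 + u))
      (≤-<-trans (*-monoʳ-≤ (h u) (<⇒≤ rise)) (logConcave u 2+u≤n))

    fallsFrom-suc : ∀ x → FallsFrom x → FallsFrom (suc x)
    fallsFrom-suc x fall 2+x≤n = <⇒≤ (*-cancelˡ-< (h (1 + x)) (h (2 + x)) (h (1 + x))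
      (≤-<-trans (*-monoˡ-≤ (h (2 + x)) (fall (<⇒≤ 2+x≤n))) (logConcave x 2+x≤n)))

    below-maximum : ∀ {x} → x ≤ n → RisesTo x → ∀ u → u ≤ x → h u ≤ h x
    below-maximum {zero}  _   _    zero z≤n = ≤-refl
    below-maximum {suc x} x<n rise u u≤1+x with m≤n⇒m<n∨m≡n u≤1+x
    ... | inj₂ refl  = ≤-refl
    ... | inj₁ u<1+x = ≤-trans (below-maximum (<⇒≤ x<n) (risesTo-pred x x<n rise) u (s≤s⁻¹ u<1+x))
                               (<⇒≤ rise)

    fallsFrom-beyond : ∀ {x} → FallsFrom x → ∀ u → x ≤ u → FallsFrom u
    fallsFrom-beyond fall zero    z≤n = fall
    fallsFrom-beyond fall (suc u) x≤1+u with m≤n⇒m<n∨m≡n x≤1+u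
    ... | inj₂ refl  = fall
    ... | inj₁ x<1+u = fallsFrom-suc u (fallsFrom-beyond fall u (s≤s⁻¹ x<1+u))

    above-maximum : ∀ {x} → FallsFrom x → ∀ u → x ≤ u → u ≤ n → h u ≤ h x
    above-maximum fall zero    z≤n _ = ≤-refl
    above-maximum fall (suc u) x≤1+u u<n with m≤n⇒m<n∨m≡n x≤1+u
    ... | inj₂ refl  = ≤-refl
    ... | inj₁ x<1+u = ≤-trans (fallsFrom-beyond fall u (s≤s⁻¹ x<1+u) u<n)
                               (above-maximum fall u (s≤s⁻¹ x<1+u) (<⇒≤ u<n))

    local⇒maximum : ∀ {x} → x ≤ n → RisesTo x → FallsFrom x → IsMaximumAt x
    local⇒maximum {x} x≤n rise fall u u≤n with ≤-total u x
    ... | inj₁ u≤x = below-maximum x≤n rise u u≤x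
    ... | inj₂ x≤u = above-maximum fall u x≤u u≤n

  maximum⇒local : NoAdjacentTies → ∀ {x} → x ≤ n → IsMaximumAt x → RisesTo x × FallsFrom x
  maximum⇒local noTies {zero}  _   max = tt , max 1
  maximum⇒local noTies {suc x} x<n max = ≤∧≢⇒< (max x (<⇒≤ x<n)) (noTies x x<n) , max (2 + x)

  maximum⇔local : StrictlyLogConcave → NoAdjacentTies → ∀ {x} → x ≤ n →
    IsMaximumAt x ⇔ (RisesTo x × FallsFrom x)
  maximum⇔local logConcave noTies x≤n =
    mk⇔ (maximum⇒local noTies x≤n) (λ (rise , fall) → local⇒maximum logConcave x≤n rise fall)

-- The sequence x ↦ p^C(x,2) q^C(n-x,2) r^(x(n-x))

m∸n≡1+m∸[1+n] : ∀ {m n} → suc n ≤ m → m ∸ n ≡ suc (m ∸ suc n)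
m∸n≡1+m∸[1+n] = +-∸-assoc 1

m^[n+1]≡m^n*m : ∀ m n → m ^ (n + 1) ≡ m ^ n * m
m^[n+1]≡m^n*m m n = trans (^-distribˡ-+-* m n 1) (cong (m ^ n *_) (*-identityʳ m))

*-cancelʳ-<-⇔ : ∀ o .{{_ : NonZero o}} {m n} → (m * o < n * o) ⇔ (m < n)
*-cancelʳ-<-⇔ o = mk⇔ (*-cancelʳ-< o _ _) (*-monoˡ-< o)

*-cancelʳ-≤-⇔ : ∀ o .{{_ : NonZero o}} {m n} → (m * o ≤ n * o) ⇔ (m ≤ n)
*-cancelʳ-≤-⇔ o = mk⇔ (*-cancelʳ-≤ _ _ o) (*-monoˡ-≤ o)

coprime-divisor-^ : ∀ {r q} → Coprime r q → ∀ e {c} → r ∣ q ^ e * c → r ∣ c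
coprime-divisor-^ {r}     r⊥q zero    {c} r∣1*c = subst (r ∣_) (*-identityˡ c) r∣1*c
coprime-divisor-^ {r} {q} r⊥q (suc e) {c} r∣qqᵉc =
  coprime-divisor-^ r⊥q e (coprime-divisor r⊥q (subst (r ∣_) (*-assoc q (q ^ e) c) r∣qqᵉc))

module TwoBlock (p q r : ℕ) {{_ : NonZero p}} (p<q : p < q) (q<r : q < r) (r⊥q : Coprime r q) where

  private
    p<r : p < r
    p<r = <-trans p<q q<r

    instance
      q≢0 : NonZero q
      q≢0 = >-nonZero (≤-<-trans z≤n p<q)
      r≢0 : NonZero r
      r≢0 = >-nonZero (≤-<-trans z≤n p<r)

  p^d*p^y<r^d*q^y : ∀ d y .{{_ : NonZero (d + y)}} → p ^ d * p ^ y < r ^ d * q ^ y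
  p^d*p^y<r^d*q^y d y = begin-strict
    p ^ d * p ^ y  ≡⟨ ^-distribˡ-+-* p d y ⟨
    p ^ (d + y)    <⟨ ^-monoˡ-< (d + y) p<q ⟩
    q ^ (d + y)    ≡⟨ ^-distribˡ-+-* q d y ⟩
    q ^ d * q ^ y  ≤⟨ *-monoˡ-≤ (q ^ y) (^-monoˡ-≤ d (<⇒≤ q<r)) ⟩
    r ^ d * q ^ y  ∎
    where open ≤-Reasoning

  r∤q^ : ∀ e → ¬ (r ∣ q ^ e)
  r∤q^ e r∣qᵉ = <⇒≢ (≤-<-trans (>-nonZero⁻¹ q) q<r)
    (sym (∣1⇒≡1 (coprime-divisor-^ r⊥q e (subst (r ∣_) (sym (*-identityʳ (q ^ e))) r∣qᵉ))))

  power-tie-≥ : ∀ {x y} → (Σ ℕ λ d → y + d ≡ x) → r ^ x * q ^ y ≡ p ^ x * r ^ y → x ≡ 0 × y ≡ 0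
  power-tie-≥ {y = y} (d , refl) eq = both-zero d y cancelled
    where
    open ≡-Reasoning
    cancelled : r ^ d * q ^ y ≡ p ^ d * p ^ y
    cancelled = *-cancelˡ-≡ _ _ (r ^ y) {{m^n≢0 r y}} (begin
      r ^ y * (r ^ d * q ^ y)    ≡⟨ *-assoc (r ^ y) (r ^ d) (q ^ y) ⟨
      r ^ y * r ^ d * q ^ y      ≡⟨ cong (_* q ^ y) (^-distribˡ-+-* r y d) ⟨
      r ^ (y + d) * q ^ y        ≡⟨ eq ⟩
      p ^ (y + d) * r ^ y        ≡⟨ cong (_* r ^ y) (^-distribˡ-+-* p y d) ⟩
      p ^ y * p ^ d * r ^ y      ≡⟨ solve 3 (λ py pd ry → py :* pd :* ry := ry :* (pd :* py)) refl
                                            (p ^ y) (p ^ d) (r ^ y) ⟩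
      r ^ y * (p ^ d * p ^ y)    ∎)
    both-zero : ∀ d y → r ^ d * q ^ y ≡ p ^ d * p ^ y → y + d ≡ 0 × y ≡ 0
    both-zero zero    zero    _  = refl , refl
    both-zero (suc d) y       eq = ⊥-elim (<-irrefl (sym eq) (p^d*p^y<r^d*q^y (suc d) y))
    both-zero zero    (suc y) eq = ⊥-elim (<-irrefl (sym eq) (p^d*p^y<r^d*q^y zero (suc y)))

  power-tie-< : ∀ {x y} → (Σ ℕ λ d → suc x + d ≡ y) → r ^ x * q ^ y ≢ p ^ x * r ^ y
  power-tie-< {x} (d , refl) eq = r∤q^ (suc x + d) (divides (p ^ x * r ^ d) cancelled)
    where
    open ≡-Reasoning
    cancelled : q ^ (suc x + d) ≡ p ^ x * r ^ d * r
    cancelled = *-cancelˡ-≡ _ _ (r ^ x) {{m^n≢0 r x}} (begin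
      r ^ x * q ^ (suc x + d)        ≡⟨ eq ⟩
      p ^ x * (r * r ^ (x + d))      ≡⟨ cong (λ e → p ^ x * (r * e)) (^-distribˡ-+-* r x d) ⟩
      p ^ x * (r * (r ^ x * r ^ d))  ≡⟨ solve 4 (λ px r' rx rd → px :* (r' :* (rx :* rd)) := rx :* (px :* rd :* r'))
                                                refl (p ^ x) r (r ^ x) (r ^ d) ⟩
      r ^ x * (p ^ x * r ^ d * r)    ∎)

  power-tie : ∀ x y → r ^ x * q ^ y ≡ p ^ x * r ^ y → x ≡ 0 × y ≡ 0
  power-tie x y eq with y ≤? x
  ... | yes y≤x = power-tie-≥ (m≤n⇒∃[o]m+o≡n y≤x) eq
  ... | no  y≰x = ⊥-elim (power-tie-< (m≤n⇒∃[o]m+o≡n (≰⇒> y≰x)) eq)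

  Φ : ℕ → ℕ → ℕ
  Φ = twoBlockProduct p q r

  Φ≢0 : ∀ x y → NonZero (Φ x y)
  Φ≢0 x y = m*n≢0 _ _ {{m*n≢0 _ _ {{m^n≢0 p (x C 2)}} {{m^n≢0 q (y C 2)}}}} {{m^n≢0 r (x * y)}}

  Φ-exchange-< : ∀ x y → (Φ x (suc y) < Φ (suc x) y) ⇔ (r ^ x * q ^ y < p ^ x * r ^ y)
  Φ-exchange-< x y = begin
    (Φ x (suc y) < Φ (suc x) y)
      ≡⟨ cong₂ _<_ (twoBlockProduct-sucʳ p q r x y) (twoBlockProduct-sucˡ p q r x y) ⟩
    (r ^ x * q ^ y * Φ x y < p ^ x * r ^ y * Φ x y)    ≈⟨ *-cancelʳ-<-⇔ (Φ x y) {{Φ≢0 x y}} ⟩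
    (r ^ x * q ^ y < p ^ x * r ^ y)                    ∎
    where open ⇔-Reasoning

  Φ-exchange-≤ : ∀ x y → (Φ (suc x) y ≤ Φ x (suc y)) ⇔ (p ^ x * r ^ y ≤ r ^ x * q ^ y)
  Φ-exchange-≤ x y = begin
    (Φ (suc x) y ≤ Φ x (suc y))
      ≡⟨ cong₂ _≤_ (twoBlockProduct-sucˡ p q r x y) (twoBlockProduct-sucʳ p q r x y) ⟩
    (p ^ x * r ^ y * Φ x y ≤ r ^ x * q ^ y * Φ x y)    ≈⟨ *-cancelʳ-≤-⇔ (Φ x y) {{Φ≢0 x y}} ⟩
    (p ^ x * r ^ y ≤ r ^ x * q ^ y)                    ∎
    where open ⇔-Reasoning

  Φ-exchange-≡ : ∀ x y → Φ x (suc y) ≡ Φ (suc x) y → x ≡ 0 × y ≡ 0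
  Φ-exchange-≡ x y eq = power-tie x y (*-cancelʳ-≡ _ _ (Φ x y) {{Φ≢0 x y}}
    (trans (sym (twoBlockProduct-sucʳ p q r x y)) (trans eq (twoBlockProduct-sucˡ p q r x y))))

  Φ-logConcave : ∀ x y → Φ x (2 + y) * Φ (2 + x) y < Φ (1 + x) (1 + y) * Φ (1 + x) (1 + y)
  Φ-logConcave x y = begin-strict
    Φ x (2 + y) * Φ (2 + x) y
      ≡⟨ cong₂ _*_ (twoBlockProduct-sucʳ p q r x (1 + y)) (twoBlockProduct-sucˡ p q r (1 + x) y) ⟩
    r ^ x * (q * q ^ y) * Φ₁ * (p * p ^ x * r ^ y * Φ₂)
      ≡⟨ solve 8 (λ p' q' rx qy px ry g₁ g₂ → rx :* (q' :* qy) :* g₁ :* (p' :* px :* ry :* g₂)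
                                            := p' :* q' :* (rx :* qy :* px :* ry :* g₁ :* g₂))
           refl p q (r ^ x) (q ^ y) (p ^ x) (r ^ y) Φ₁ Φ₂ ⟩
    p * q * K
      <⟨ *-monoˡ-< K {{K≢0}} (*-mono-< p<r q<r) ⟩
    r * r * K
      ≡⟨ solve 8 (λ r' q' rx qy px ry g₁ g₂ → r' :* r' :* (rx :* qy :* px :* ry :* g₁ :* g₂)
                                            := px :* (r' :* ry) :* g₁ :* (r' :* rx :* qy :* g₂))
           refl r q (r ^ x) (q ^ y) (p ^ x) (r ^ y) Φ₁ Φ₂ ⟩
    p ^ x * (r * r ^ y) * Φ₁ * (r * r ^ x * q ^ y * Φ₂)
      ≡⟨ cong₂ _*_ (twoBlockProduct-sucˡ p q r x (1 + y)) (twoBlockProduct-sucʳ p q r (1 + x) y) ⟨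
    Φ (1 + x) (1 + y) * Φ (1 + x) (1 + y) ∎
    where
    open ≤-Reasoning
    Φ₁ = Φ x (1 + y)
    Φ₂ = Φ (1 + x) y
    K = r ^ x * q ^ y * p ^ x * r ^ y * Φ₁ * Φ₂
    K≢0 : NonZero K
    K≢0 = m*n≢0 _ _ {{m*n≢0 _ _ {{m*n≢0 _ _ {{m*n≢0 _ _ {{m*n≢0 _ _ {{m^n≢0 r x}} {{m^n≢0 q y}}}}
                                                          {{m^n≢0 p x}}}}
                                            {{m^n≢0 r y}}}}
                              {{Φ≢0 x (1 + y)}}}}
                {{Φ≢0 (1 + x) y}}

  seq : ℕ → ℕ → ℕ
  seq n x = Φ x (n ∸ x)

  seq-pred : ∀ {n u} → suc u ≤ n → seq n u ≡ Φ u (suc (n ∸ suc u))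
  seq-pred {u = u} u<n = cong (Φ u) (m∸n≡1+m∸[1+n] u<n)

  seq-logConcave : ∀ n → Unimodal.StrictlyLogConcave (seq n) n
  seq-logConcave n u 2+u≤n = subst₂ _<_ (cong (_* seq n (2 + u)) (sym seq-u)) (sym (cong₂ _*_ seq-1+u seq-1+u))
    (Φ-logConcave u (n ∸ (2 + u)))
    where
    seq-1+u : seq n (1 + u) ≡ Φ (1 + u) (1 + (n ∸ (2 + u)))
    seq-1+u = seq-pred 2+u≤n
    seq-u : seq n u ≡ Φ u (2 + (n ∸ (2 + u)))
    seq-u = trans (seq-pred (<⇒≤ 2+u≤n)) (cong (λ m → Φ u (suc m)) (m∸n≡1+m∸[1+n] 2+u≤n))

  seq-noTies : ∀ {n} → 2 ≤ n → Unimodal.NoAdjacentTies (seq n) n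
  seq-noTies {n} 2≤n u u<n tie with Φ-exchange-≡ u (n ∸ suc u) (trans (sym (seq-pred u<n)) tie)
  ... | refl , n∸1≡0 = ≤⇒≯ (m∸n≡0⇒m≤n n∸1≡0) 2≤n

  -- For (p, q, r) = (a ∸ 2, a, a + 1), Lower n x × Upper n x is InWindow a n x.
  Lower : ℕ → ℕ → Set
  Lower n x = q ^ (n ∸ x) * p * r ^ x < p ^ x * r ^ (n ∸ x + 1)

  Upper : ℕ → ℕ → Set
  Upper n x = q * p ^ x * r ^ (n ∸ x) ≤ q ^ (n ∸ x) * r ^ (x + 1)

  lower-zero : ∀ n → Lower n 0
  lower-zero n = begin-strict
    q ^ n * p * 1    ≡⟨ *-identityʳ (q ^ n * p) ⟩
    q ^ n * p        ≤⟨ *-monoˡ-≤ p (^-monoˡ-≤ n (<⇒≤ q<r)) ⟩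
    r ^ n * p        <⟨ *-monoʳ-< (r ^ n) {{m^n≢0 r n}} p<r ⟩
    r ^ n * r        ≡⟨ m^[n+1]≡m^n*m r n ⟨
    r ^ (n + 1)      ≡⟨ *-identityˡ (r ^ (n + 1)) ⟨
    1 * r ^ (n + 1)  ∎
    where open ≤-Reasoning

  upper-top : ∀ n → Upper n n
  upper-top n = subst (λ m → q * p ^ n * r ^ m ≤ q ^ m * r ^ (n + 1)) (sym (n∸n≡0 n)) (begin
    q * p ^ n * 1    ≡⟨ *-identityʳ (q * p ^ n) ⟩
    q * p ^ n        ≤⟨ *-mono-≤ (<⇒≤ q<r) (^-monoˡ-≤ n (<⇒≤ p<r)) ⟩
    r * r ^ n        ≡⟨ cong (r ^_) (+-comm n 1) ⟨
    r ^ (n + 1)      ≡⟨ *-identityˡ (r ^ (n + 1)) ⟨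
    1 * r ^ (n + 1)  ∎)
    where open ≤-Reasoning

  lower⇔risesTo : ∀ {n} x → x ≤ n → Lower n x ⇔ Unimodal.RisesTo (seq n) n x
  lower⇔risesTo {n} zero    _   = mk⇔ (const tt) (const (lower-zero n))
  lower⇔risesTo {n} (suc u) u<n = begin
    Lower n (suc u)
      ≡⟨ cong₂ _<_ lhs rhs ⟩
    (r ^ u * q ^ v * (p * r) < p ^ u * r ^ v * (p * r))   ≈⟨ *-cancelʳ-<-⇔ (p * r) {{m*n≢0 p r}} ⟩
    (r ^ u * q ^ v < p ^ u * r ^ v)                       ≈⟨ Φ-exchange-< u v ⟨
    (Φ u (suc v) < Φ (suc u) v)                           ≡⟨ cong (_< Φ (suc u) v) (seq-pred u<n) ⟨
    (seq n u < seq n (suc u))                             ∎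
    where
    open ⇔-Reasoning
    v = n ∸ suc u
    lhs : q ^ v * p * r ^ suc u ≡ r ^ u * q ^ v * (p * r)
    lhs = solve 4 (λ qv p' r' ru → qv :* p' :* (r' :* ru) := ru :* qv :* (p' :* r')) refl (q ^ v) p r (r ^ u)
    rhs : p ^ suc u * r ^ (v + 1) ≡ p ^ u * r ^ v * (p * r)
    rhs = trans (cong (p ^ suc u *_) (m^[n+1]≡m^n*m r v))
                (solve 4 (λ p' pu rv r' → p' :* pu :* (rv :* r') := pu :* rv :* (p' :* r')) refl p (p ^ u) (r ^ v) r)

  upper⇔fallsFrom : ∀ {n} x → x ≤ n → Upper n x ⇔ Unimodal.FallsFrom (seq n) n x
  upper⇔fallsFrom {n} x x≤n with m≤n⇒m<n∨m≡n x≤n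
  ... | inj₂ refl = mk⇔ (λ _ 1+n≤n → ⊥-elim (1+n≰n 1+n≤n)) (const (upper-top n))
  ... | inj₁ x<n  = begin
    Upper n x
      ≡⟨ cong (λ m → q * p ^ x * r ^ m ≤ q ^ m * r ^ (x + 1)) (m∸n≡1+m∸[1+n] x<n) ⟩
    (q * p ^ x * r ^ suc v ≤ q ^ suc v * r ^ (x + 1))
      ≡⟨ cong₂ _≤_ lhs rhs ⟩
    (p ^ x * r ^ v * (q * r) ≤ r ^ x * q ^ v * (q * r))   ≈⟨ *-cancelʳ-≤-⇔ (q * r) {{m*n≢0 q r}} ⟩
    (p ^ x * r ^ v ≤ r ^ x * q ^ v)                       ≈⟨ Φ-exchange-≤ x v ⟨
    (Φ (suc x) v ≤ Φ x (suc v))                           ≡⟨ cong (Φ (suc x) v ≤_) (seq-pred x<n) ⟨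
    (seq n (suc x) ≤ seq n x)                             ≈⟨ mk⇔ const (_$ x<n) ⟩
    Unimodal.FallsFrom (seq n) n x                        ∎
    where
    open ⇔-Reasoning
    v = n ∸ suc x
    lhs : q * p ^ x * r ^ suc v ≡ p ^ x * r ^ v * (q * r)
    lhs = solve 4 (λ q' px r' rv → q' :* px :* (r' :* rv) := px :* rv :* (q' :* r')) refl q (p ^ x) r (r ^ v)
    rhs : q ^ suc v * r ^ (x + 1) ≡ r ^ x * q ^ v * (q * r)
    rhs = trans (cong (q ^ suc v *_) (m^[n+1]≡m^n*m r x))
                (solve 4 (λ q' qv rx r' → q' :* qv :* (rx :* r') := rx :* qv :* (q' :* r')) refl q (q ^ v) (r ^ x) r)

  window⇔maximum : ∀ {n x} → 2 ≤ n → x ≤ n → (Lower n x × Upper n x) ⇔ Unimodal.IsMaximumAt (seq n) n x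
  window⇔maximum {n} {x} 2≤n x≤n = ⇔-trans (lower⇔risesTo x x≤n ×-⇔ upper⇔fallsFrom x x≤n)
    (⇔-sym (Unimodal.maximum⇔local (seq n) n (seq-logConcave n) (seq-noTies 2≤n) x≤n))

-- The extremal graphs of T₂,₂(a,n)

realisation : ∀ a {n u} → u ≤ n → Σ (Multigraph n) λ w → InT22 a n w × P n w ≡ Π-formula a n u
realisation a {n} {u} u≤n = canonical a part , (part , canonical-hasPartition a part) ,
  trans (P≡Π-formula {a} {n} {part} {canonical a part} (canonical-hasPartition a part))
        (cong (Π-formula a n) (sizeV₀-prefixColouring u≤n))
  where
  part = prefixColouring u

extremal⇔maximum : ∀ {a n part w} → HasPartition a n part w →
  IsExtremal a n w ⇔ Unimodal.IsMaximumAt (Π-formula a n) n (sizeV₀ n part)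
extremal⇔maximum {a} {n} {part} {w} hp = mk⇔ to from
  where
  to : IsExtremal a n w → Unimodal.IsMaximumAt (Π-formula a n) n (sizeV₀ n part)
  to extremal u u≤n with realisation a u≤n
  ... | w′ , inT , P≡ = subst₂ _≤_ P≡ (P≡Π-formula hp) (extremal w′ inT)
  from : Unimodal.IsMaximumAt (Π-formula a n) n (sizeV₀ n part) → IsExtremal a n w
  from maximum w′ (part′ , hp′) = subst₂ _≤_ (sym (P≡Π-formula hp′)) (sym (P≡Π-formula hp))
    (maximum (sizeV₀ n part′) (sizeV₀≤n n part′))

window⇔maximum : ∀ {a n x} → 3 ≤ a → 2 ≤ n → x ≤ n →
  InWindow a n x ⇔ Unimodal.IsMaximumAt (Π-formula a n) n x
window⇔maximum {a@(suc (suc (suc k)))} (s≤s (s≤s (s≤s _))) =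
  TwoBlock.window⇔maximum (suc k) a (a + 1) (m<n+m (suc k) {2} z<s) (m<m+n a z<s) (coprime-+ (1-coprimeTo a))

lemma2p2 : (a n : ℕ) → 3 ≤ a → 5 ≤ n → (w : Multigraph n) → (part : Fin n → Bool)
           → HasPartition a n part w
           → (IsExtremal a n w ⇔ InWindow a n (sizeV₀ n part))
             × (InWindow a n (sizeV₀ n part) → IsΠ22 a n (Π-formula a n (sizeV₀ n part)))
lemma2p2 a n 3≤a 5≤n w part hp = extremal⇔window , Π22
  where
  extremal⇔window : IsExtremal a n w ⇔ InWindow a n (sizeV₀ n part)
  extremal⇔window = ⇔-trans (extremal⇔maximum hp)
    (⇔-sym (window⇔maximum 3≤a (≤-trans (s≤s (s≤s z≤n)) 5≤n) (sizeV₀≤n n part)))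
  Π22 : InWindow a n (sizeV₀ n part) → IsΠ22 a n (Π-formula a n (sizeV₀ n part))
  Π22 window = (w , (part , hp) , P≡Π-formula hp) ,
    λ w′ inT → subst (P n w′ ≤_) (P≡Π-formula hp) (Equivalence.from extremal⇔window window w′ inT)
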